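{- Let $n\geq 1$, $q$ a prime power, and $T\subseteq GF(q)^n$ a vector space over $GF(q)$. Then $\mathrm{Matroid}(T)$ is the cycle matroid of a subdivision of $A_t$ for some $t\geq 3$ if and only if $T$ is generated by a sunflower basis.
   Context: $\mathrm{Matroid}(T)$ is the matroid on $[n]$ represented over $GF(q)$ by any matrix $A$ with $T=\{x\in GF(q)^n: Ax=\mathbf{0}\}$; equivalently, its circuits are the inclusion-minimal sets among $\{\mathrm{support}(x): x\in T, x\neq\mathbf{0}\}$, where $\mathrm{support}(x)=\{i:x_i\neq 0\}$. For $t\geq 3$, $A_t$ is the graph with two vertices and $t$ parallel edges between them. Row vectors $v^1,\dots,v^r$ with $r\geq 2$ form a sunflower if, after permuting coordinates, $v^i=(u^0,\mathbf{0},\dots,\mathbf{0},u^i,\mathbf{0},\dots,\mathbf{0})$ for $i=1,\dots,r$ (the block $u^i$ in the $(i+1)$-th block position), where $u^0,u^1,\dots,u^r$ are row vectors all of whose entries are nonzero. A sunflower basis is a basis of $T$ whose vectors form a sunflower. -}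

module Defs where

open import Level using (0ℓ) renaming (suc to lsuc)
open import Data.Nat using (ℕ; zero; suc; _^_; _≤_; _<?_)
open import Data.Nat.Primality using (Prime)
open import Data.Fin using (Fin; zero; suc; fromℕ<; toℕ)
open import Data.Fin.Properties using (toℕ-fromℕ<; toℕ<n)
import Data.Nat
import Data.Nat.Properties
open import Function using (case_of_)
open import Data.Product using (Σ; ∃; ∃₂; _×_; _,_; proj₁; proj₂)
open import Data.Sum using (_⊎_)
open import Relation.Nullary using (¬_; yes; no)
open import Relation.Binary.PropositionalEquality using (_≡_; _≢_)
import Relation.Binary.PropositionalEquality as ≡
open import Algebra.Bundles using (CommutativeRing)
open import Function.Bundles using (Inverse; _⇔_)

IsPrimePower : ℕ → Set
IsPrimePower q = ∃₂ λ p k → Prime p × q ≡ p ^ suc k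

record Field : Set₁ where
  field
    commutativeRing : CommutativeRing 0ℓ 0ℓ
  open CommutativeRing commutativeRing public
  field
    1≉0     : ¬ (1# ≈ 0#)
    inverse : ∀ x → ¬ (x ≈ 0#) → ∃ λ y → (x * y) ≈ 1#

-- F is (a copy of) GF(q): a field with exactly q elements.
HasOrder : Field → ℕ → Set
HasOrder F q = Inverse (Field.setoid F) (≡.setoid (Fin q))

module LinAlg (F : Field) where
  open Field F hiding (zero)

  Vect : ℕ → Set
  Vect n = Fin n → Carrier

  ∑ : ∀ {r} → (Fin r → Carrier) → Carrier
  ∑ {zero}  f = 0#
  ∑ {suc r} f = f zero + ∑ (λ i → f (suc i))

  lincomb : ∀ {r n} → (Fin r → Carrier) → (Fin r → Vect n) → Vect n
  lincomb c v j = ∑ (λ i → c i * v i j)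

  _≋_ : ∀ {n} → Vect n → Vect n → Set
  x ≋ y = ∀ j → x j ≈ y j

  IsZero : ∀ {n} → Vect n → Set
  IsZero x = ∀ j → x j ≈ 0#

  record Subspace (n : ℕ) : Set₁ where
    field
      _∈T     : Vect n → Set
      resp    : ∀ {x y} → x ≋ y → x ∈T → y ∈T
      zero∈   : (λ _ → 0#) ∈T
      +-closed : ∀ {x y} → x ∈T → y ∈T → (λ j → x j + y j) ∈T
      *-closed : ∀ a {x} → x ∈T → (λ j → a * x j) ∈T
  open Subspace public

  SubsetN : ℕ → Set₁
  SubsetN n = Fin n → Set

  _⊆_ : ∀ {A : Set} → (A → Set) → (A → Set) → Set
  S ⊆ S' = ∀ i → S i → S' i

  support : ∀ {n} → Vect n → SubsetN n
  support x i = ¬ (x i ≈ 0#)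

  IsSupportOf : ∀ {n} → SubsetN n → Vect n → Set
  IsSupportOf S x = ∀ i → (S i → support x i) × (support x i → S i)

  IsCircuit : ∀ {n} → Subspace n → SubsetN n → Set
  IsCircuit T S =
    (∃ λ x → (_∈T T x) × ¬ IsZero x × IsSupportOf S x)
    × (∀ y → _∈T T y → ¬ IsZero y → support y ⊆ S → S ⊆ support y)

  IsBasis : ∀ {n r} → Subspace n → (Fin r → Vect n) → Set
  IsBasis T v =
    (∀ i → _∈T T (v i))
    × (∀ c → IsZero (lincomb c v) → ∀ i → c i ≈ 0#)
    × (∀ x → _∈T T x → ∃ λ c → x ≋ lincomb c v)

  -- v¹,…,vʳ (r ≥ 2) form a sunflower: the coordinates are partitioned into
  -- nonempty blocks B₀, B₁, …, Bᵣ (block β j of coordinate j), with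
  -- vⁱ = u⁰ on B₀, vⁱ = uⁱ on Bᵢ, vⁱ = 0 elsewhere, all entries of
  -- u⁰, uⁱ nonzero.  (This is "after permuting coordinates,
  -- vⁱ = (u⁰,0,…,0,uⁱ,0,…,0)".)
  IsSunflower : ∀ {n r} → (Fin r → Vect n) → Set
  IsSunflower {n} {r} v =
    2 ≤ r × Σ (Fin n → Fin (suc r)) λ β → Σ (Vect n) λ u⁰ →
      (∀ b → ∃ λ j → β j ≡ b)
      × (∀ i j → β j ≡ zero → v i j ≈ u⁰ j × ¬ (u⁰ j ≈ 0#))
      × (∀ i j → β j ≡ suc i → ¬ (v i j ≈ 0#))
      × (∀ i k j → β j ≡ suc k → k ≢ i → v i j ≈ 0#)

  HasSunflowerBasis : ∀ {n} → Subspace n → Set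
  HasSunflowerBasis {n} T =
    ∃ λ r → Σ (Fin r → Vect n) λ v → IsBasis T v × IsSunflower v

record Graph : Set₁ where
  field
    V        : Set
    E        : Set
    ends     : E → V × V
    loopless : ∀ e → proj₁ (ends e) ≢ proj₂ (ends e)

module GraphNotions (G : Graph) where
  open Graph G

  Inc : E → V → Set
  Inc e v = proj₁ (ends e) ≡ v ⊎ proj₂ (ends e) ≡ v

  EdgeSet : Set₁
  EdgeSet = E → Set

  NonEmpty : EdgeSet → Set
  NonEmpty C = ∃ λ e → C e

  Deg0or2 : EdgeSet → Set
  Deg0or2 C = ∀ v →
    (∀ e → C e → ¬ Inc e v)
    ⊎ (∃₂ λ e₁ e₂ → e₁ ≢ e₂ × C e₁ × C e₂ × Inc e₁ v × Inc e₂ v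
                    × (∀ e → C e → Inc e v → e ≡ e₁ ⊎ e ≡ e₂))

  -- edge sets of cycles: inclusion-minimal nonempty edge sets in which
  -- every vertex has degree 0 or 2 (i.e. connected 2-regular subgraphs)
  IsCycle : EdgeSet → Set₁
  IsCycle C = Deg0or2 C × NonEmpty C
    × (∀ (D : EdgeSet) → (∀ e → D e → C e) → Deg0or2 D → NonEmpty D → ∀ e → C e → D e)

-- Subdivisions of A_t: the t parallel edges of A_t (between hubs a and b)
-- are replaced by paths with suc (ℓ i) ≥ 1 edges.  Every subdivision of
-- A_t is isomorphic to SubA t ℓ for some ℓ.

data SubAV (t : ℕ) (ℓ : Fin t → ℕ) : Set where
  hubA  : SubAV t ℓ
  hubB  : SubAV t ℓ
  inner : (i : Fin t) → Fin (ℓ i) → SubAV t ℓ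

-- the vertex at position p (0 … suc (ℓ i)) along path i
pathPos : ∀ {t ℓ} (i : Fin t) → ℕ → SubAV t ℓ
pathPos i zero = hubA
pathPos {ℓ = ℓ} i (suc p) with p <? ℓ i
... | yes p<ℓ = inner i (fromℕ< p<ℓ)
... | no  _   = hubB

SubAE : (t : ℕ) → (Fin t → ℕ) → Set
SubAE t ℓ = Σ (Fin t) λ i → Fin (suc (ℓ i))

subAEnds : ∀ t ℓ → SubAE t ℓ → SubAV t ℓ × SubAV t ℓ
subAEnds t ℓ (i , k) = pathPos i (toℕ k) , pathPos i (suc (toℕ k))

private
  inner-inj : ∀ {t ℓ i} {a b : Fin (ℓ i)} → inner {t} {ℓ} i a ≡ inner i b → a ≡ b
  inner-inj ≡.refl = ≡.refl

  pathPos-step : ∀ {t ℓ} (i : Fin t) p → p Data.Nat.< suc (ℓ i) →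
                 pathPos {t} {ℓ} i p ≢ pathPos i (suc p)
  pathPos-step {ℓ = ℓ} i zero _ eq with 0 <? ℓ i
  ... | yes _ = case eq of λ ()
  ... | no  _ = case eq of λ ()
  pathPos-step {ℓ = ℓ} i (suc p) (Data.Nat.s≤s p<ℓ) eq with p <? ℓ i | suc p <? ℓ i
  ... | no ¬p | _ = ¬p p<ℓ
  ... | yes a | yes b = Data.Nat.Properties.<-irrefl
        (≡.trans (≡.sym (toℕ-fromℕ< a))
          (≡.trans (≡.cong toℕ (inner-inj eq)) (toℕ-fromℕ< b))) (Data.Nat.Properties.n<1+n p)
  ... | yes a | no  _ = case eq of λ ()

subALoopless : ∀ t ℓ (e : SubAE t ℓ) → proj₁ (subAEnds t ℓ e) ≢ proj₂ (subAEnds t ℓ e)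
subALoopless t ℓ (i , k) = pathPos-step i (toℕ k) (toℕ<n k)

SubA : (t : ℕ) → (Fin t → ℕ) → Graph
SubA t ℓ = record
  { V = SubAV t ℓ ; E = SubAE t ℓ ; ends = subAEnds t ℓ ; loopless = subALoopless t ℓ }

-- Matroid(T) is the cycle matroid of G: a bijection between [n] and the
-- edges of G under which the circuits of Matroid(T) are exactly the
-- edge sets of cycles of G.

module _ (F : Field) where
  open LinAlg F

  IsCycleMatroidOf : ∀ {n} → Subspace n → Graph → Set₁
  IsCycleMatroidOf {n} T G =
    Σ (Inverse (≡.setoid (Fin n)) (≡.setoid (Graph.E G))) λ φ →
      ∀ (S : SubsetN n) →
        (IsCircuit T S → GraphNotions.IsCycle G (λ e → S (Inverse.from φ e)))
        × (GraphNotions.IsCycle G (λ e → S (Inverse.from φ e)) → IsCircuit T S)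

  IsCycleMatroidOfSubdivA : ∀ {n} → Subspace n → Set₁
  IsCycleMatroidOfSubdivA T =
    ∃₂ λ t (ℓ : Fin t → ℕ) → 3 ≤ t × IsCycleMatroidOf T (SubA t ℓ)

{-# OPTIONS --safe #-}
module Submission where

-- Both conditions say that the ground set splits into t ≥ 3 nonempty blocks whose
-- unions of two blocks are exactly the circuits.  In a subdivision of A_t the blocks
-- are the t subdivided parallel edges, since an even subgraph that meets a path
-- contains all of it and, at the hubs, a second path.  For a sunflower basis
-- v¹, …, vʳ the blocks are B₀, B₁, …, Bᵣ: the vector ∑ dᵢ vⁱ is nonzero exactly on the
-- blocks where the weight (∑ dᵢ, d₁, …, dᵣ) is nonzero, and a nonzero weight never has
-- a single nonzero entry.  Conversely, when the circuits are the unions of two blocks,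
-- a vector of T vanishing somewhere in every block but one is zero (its support would
-- contain a circuit), which makes normalised circuit vectors on B₀ ∪ Bᵢ a sunflower basis.

open import Defs
open import Data.Nat using (ℕ; zero; suc; pred; _≤_; z≤n; s≤s; _<?_)
open import Data.Nat.Properties using (≤-trans; ≤-antisym; ≤-pred; <-irrefl; ≮⇒≥; 1+n≢n)
import Data.Nat.Properties as ℕ
open import Data.Product using (Σ; ∃; _×_; _,_; proj₁; proj₂)
open import Data.Sum using (_⊎_; inj₁; inj₂; [_,_]′; swap)
open import Data.Empty using (⊥; ⊥-elim)
open import Data.Bool using (Bool; true)
open import Data.Fin using (Fin; zero; suc; toℕ; fromℕ; inject₁; cast; _≟_)
open import Data.Fin.Properties
  using (toℕ<n; toℕ-injective; toℕ-fromℕ; toℕ-fromℕ<; fromℕ<-toℕ; toℕ-inject₁; cast-involutive;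
         ¬∀⟶∃¬; 0≢1+n; suc-injective)
import Data.Fin.Subset as Subset
open import Data.Fin.Subset.Induction using (⊂-wellFounded; Acc; acc)
open import Data.Vec using (tabulate)
open import Data.Vec.Properties using (lookup∘tabulate; []=⇒lookup; lookup⇒[]=)
open import Function using (_∘_; case_of_)
open import Function.Bundles using (Equivalence; _⇔_; mk⇔; Inverse; _↔_; mk↔ₛ′)
open import Function.Properties.Equivalence using () renaming (refl to ⇔-refl; trans to ⇔-trans; sym to ⇔-sym)
open import Function.Properties.Inverse using (Inverse⇒Injection)
open import Relation.Nullary using (¬_; Dec; yes; no; does)
open import Relation.Nullary.Decidable using (decidable-stable; ¬?; _→-dec_; via-injection)
open import Relation.Binary using (Decidable)
open import Relation.Binary.PropositionalEquality using (_≡_; _≢_; refl; sym; trans; cong; subst; module ≡-Reasoning)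
open import Axiom.UniquenessOfIdentityProofs using (module Decidable⇒UIP)

open Equivalence using (to; from)

OneOf : {A : Set} → A → A → A → Set
OneOf a b x = x ≡ a ⊎ x ≡ b

IsTwoBlockUnion : {A B : Set} → (A → B) → (A → Set) → Set
IsTwoBlockUnion {B = B} β S = Σ B λ a → Σ B λ b → a ≢ b × (∀ x → S x ⇔ OneOf a b (β x))

subst-⇔ : ∀ {A : Set} (P : A → Set) {x y} → x ≡ y → P x ⇔ P y
subst-⇔ P refl = ⇔-refl

twoBlockUnion-transport : ∀ {A A′ B : Set} (φ : A ↔ A′) {β : A → B} {β′ : A′ → B} →
                          (∀ e → β (Inverse.from φ e) ≡ β′ e) →
                          ∀ S → IsTwoBlockUnion β′ (λ e → S (Inverse.from φ e)) ⇔ IsTwoBlockUnion β S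
twoBlockUnion-transport φ {β} {β′} β∘from S = mk⇔ pull push
  where
  open Inverse φ using () renaming (to to φ→; from to φ←)
  pull : IsTwoBlockUnion β′ (λ e → S (φ← e)) → IsTwoBlockUnion β S
  pull (a , b , a≢b , S⇔) = a , b , a≢b , λ x →
    let from∘to = Inverse.strictlyInverseʳ φ x in
    ⇔-trans (subst-⇔ S (sym from∘to))
      (⇔-trans (S⇔ (φ→ x)) (subst-⇔ (OneOf a b) (trans (sym (β∘from (φ→ x))) (cong β from∘to))))
  push : IsTwoBlockUnion β S → IsTwoBlockUnion β′ (λ e → S (φ← e))
  push (a , b , a≢b , S⇔) = a , b , a≢b , λ e → ⇔-trans (S⇔ (φ← e)) (subst-⇔ (OneOf a b) (β∘from e))

pair-other : ∀ {A : Set} {a b c c′ i : A} → OneOf a b c → OneOf a b c′ → OneOf a b i →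
             c′ ≢ c → i ≢ c → i ≡ c′
pair-other (inj₁ refl) (inj₁ refl) _           c′≢c _   = ⊥-elim (c′≢c refl)
pair-other (inj₁ refl) (inj₂ refl) (inj₁ refl) _    i≢c = ⊥-elim (i≢c refl)
pair-other (inj₁ refl) (inj₂ refl) (inj₂ refl) _    _   = refl
pair-other (inj₂ refl) (inj₁ refl) (inj₁ refl) _    _   = refl
pair-other (inj₂ refl) (inj₁ refl) (inj₂ refl) _    i≢c = ⊥-elim (i≢c refl)
pair-other (inj₂ refl) (inj₂ refl) _           c′≢c _   = ⊥-elim (c′≢c refl)

constant-on-consecutive : ∀ {m} (P : Fin (suc m) → Set) →
                          (∀ x → P (inject₁ x) ⇔ P (suc x)) → ∀ k → P k ⇔ P zero
constant-on-consecutive P step zero = mk⇔ (λ p → p) (λ p → p)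
constant-on-consecutive {suc m} P step (suc k) =
  ⇔-trans (constant-on-consecutive (λ x → P (suc x)) (λ x → step (suc x)) k) (⇔-sym (step zero))

-- Cycles of a subdivision of A_t

module SubdivisionCycles (t : ℕ) (ℓ : Fin t → ℕ) where
  open GraphNotions (SubA t ℓ)

  pathPos-suc≢hubA : ∀ (i : Fin t) p → pathPos {t} {ℓ} i (suc p) ≢ hubA
  pathPos-suc≢hubA i p eq with p <? ℓ i
  ... | yes _ = case eq of λ ()
  ... | no  _ = case eq of λ ()

  pathPos-suc≡hubB⇒ℓ≤ : ∀ (i : Fin t) p → pathPos {t} {ℓ} i (suc p) ≡ hubB → ℓ i ≤ p
  pathPos-suc≡hubB⇒ℓ≤ i p eq with p <? ℓ i
  ... | yes _  = case eq of λ ()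
  ... | no p≮ℓ = ≮⇒≥ p≮ℓ

  pathPos≡inner⇒ : ∀ (i : Fin t) p a (x : Fin (ℓ a)) →
                   pathPos {t} {ℓ} i p ≡ inner a x → i ≡ a × p ≡ suc (toℕ x)
  pathPos≡inner⇒ i zero    a x ()
  pathPos≡inner⇒ i (suc p) a x eq with p <? ℓ i
  pathPos≡inner⇒ i (suc p) a x refl | yes p<ℓ = refl , cong suc (sym (toℕ-fromℕ< p<ℓ))
  pathPos≡inner⇒ i (suc p) a x ()   | no  _

  pathPos-inner : ∀ (a : Fin t) (x : Fin (ℓ a)) → pathPos {t} {ℓ} a (suc (toℕ x)) ≡ inner a x
  pathPos-inner a x with toℕ x <? ℓ a
  ... | yes x<ℓ = cong (inner a) (fromℕ<-toℕ x x<ℓ)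
  ... | no  x≮ℓ = ⊥-elim (x≮ℓ (toℕ<n x))

  pathPos-end : ∀ (a : Fin t) → pathPos {t} {ℓ} a (suc (ℓ a)) ≡ hubB
  pathPos-end a with ℓ a <? ℓ a
  ... | yes ℓ<ℓ = ⊥-elim (<-irrefl refl ℓ<ℓ)
  ... | no  _   = refl

  first-incident-hubA : ∀ i → Inc (i , zero) hubA
  first-incident-hubA i = inj₁ refl

  incident-hubA⇒first : ∀ i k → Inc (i , k) hubA → k ≡ zero
  incident-hubA⇒first i zero    _        = refl
  incident-hubA⇒first i (suc k) (inj₁ e) = ⊥-elim (pathPos-suc≢hubA i (toℕ k) e)
  incident-hubA⇒first i (suc k) (inj₂ e) = ⊥-elim (pathPos-suc≢hubA i (suc (toℕ k)) e)

  last-incident-hubB : ∀ i → Inc (i , fromℕ (ℓ i)) hubB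
  last-incident-hubB i = inj₂ (trans (cong (λ p → pathPos i (suc p)) (toℕ-fromℕ (ℓ i))) (pathPos-end i))

  incident-hubB⇒last : ∀ i k → Inc (i , k) hubB → k ≡ fromℕ (ℓ i)
  incident-hubB⇒last i k inc = toℕ-injective (trans (position k inc) (sym (toℕ-fromℕ (ℓ i))))
    where
    position : ∀ k → Inc (i , k) hubB → toℕ k ≡ ℓ i
    position zero    (inj₁ ())
    position (suc k) (inj₁ e) =
      ⊥-elim (<-irrefl refl (≤-trans (toℕ<n (suc k)) (s≤s (pathPos-suc≡hubB⇒ℓ≤ i (toℕ k) e))))
    position k       (inj₂ e) = ≤-antisym (≤-pred (toℕ<n k)) (pathPos-suc≡hubB⇒ℓ≤ i (toℕ k) e)

  before-incident-inner : ∀ a (x : Fin (ℓ a)) → Inc (a , inject₁ x) (inner a x)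
  before-incident-inner a x = inj₂ (trans (cong (λ p → pathPos a (suc p)) (toℕ-inject₁ x)) (pathPos-inner a x))

  after-incident-inner : ∀ a (x : Fin (ℓ a)) → Inc (a , suc x) (inner a x)
  after-incident-inner a x = inj₁ (pathPos-inner a x)

  incident-inner⇒ : ∀ e a (x : Fin (ℓ a)) → Inc e (inner a x) → OneOf (a , inject₁ x) (a , suc x) e
  incident-inner⇒ (i , k) a x (inj₁ e) with pathPos≡inner⇒ i (toℕ k) a x e
  ... | refl , k≡1+x = inj₂ (cong (a ,_) (toℕ-injective k≡1+x))
  incident-inner⇒ (i , k) a x (inj₂ e) with pathPos≡inner⇒ i (suc (toℕ k)) a x e
  ... | refl , k≡x = inj₁ (cong (a ,_) (toℕ-injective (trans (ℕ.suc-injective k≡x) (sym (toℕ-inject₁ x)))))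

  before≢after : ∀ a (x : Fin (ℓ a)) → _≢_ {A = SubAE t ℓ} (a , inject₁ x) (a , suc x)
  before≢after a x eq = 1+n≢n (sym (trans (sym (toℕ-inject₁ x)) (cong (λ e → toℕ (proj₂ e)) eq)))

  even-other-edge : ∀ {C : EdgeSet} → Deg0or2 C → ∀ w e₁ e₂ → (∀ e → Inc e w → e ≡ e₁ ⊎ e ≡ e₂) →
                    Inc e₁ w → C e₁ → C e₂
  even-other-edge deg w e₁ e₂ only inc₁ c₁ with deg w
  ... | inj₁ none = ⊥-elim (none e₁ c₁ inc₁)
  ... | inj₂ (f₁ , f₂ , f₁≢f₂ , cf₁ , cf₂ , incf₁ , incf₂ , _) with only f₁ incf₁ | only f₂ incf₂
  ... | inj₂ refl | _         = cf₁
  ... | inj₁ _    | inj₂ refl = cf₂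
  ... | inj₁ refl | inj₁ refl = ⊥-elim (f₁≢f₂ refl)

  even-whole-path : ∀ {C : EdgeSet} → Deg0or2 C → ∀ a k k′ → C (a , k) → C (a , k′)
  even-whole-path {C} deg a k k′ c = from (along k′) (to (along k) c)
    where
    step : ∀ x → C (a , inject₁ x) ⇔ C (a , suc x)
    step x = mk⇔ (even-other-edge deg (inner a x) _ _ (λ e → incident-inner⇒ e a x) (before-incident-inner a x))
                 (even-other-edge deg (inner a x) _ _ (λ e i → swap (incident-inner⇒ e a x i)) (after-incident-inner a x))
    along : ∀ k → C (a , k) ⇔ C (a , zero)
    along = constant-on-consecutive (λ k → C (a , k)) step

  even-second-path : ∀ {C : EdgeSet} → Deg0or2 C → ∀ a → C (a , zero) → ∃ λ b → b ≢ a × C (b , zero)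
  even-second-path deg a c with deg hubA
  ... | inj₁ none = ⊥-elim (none (a , zero) c (first-incident-hubA a))
  ... | inj₂ ((i₁ , k₁) , (i₂ , k₂) , e₁≢e₂ , c₁ , c₂ , inc₁ , inc₂ , _)
    with incident-hubA⇒first i₁ k₁ inc₁ | incident-hubA⇒first i₂ k₂ inc₂
  ... | refl | refl with i₁ ≟ a
  ... | yes refl = i₂ , (λ i₂≡a → e₁≢e₂ (cong (_, zero) (sym i₂≡a))) , c₂
  ... | no i₁≢a  = i₁ , i₁≢a , c₁

  TwoPaths : Fin t → Fin t → EdgeSet
  TwoPaths a b e = OneOf a b (proj₁ e)

  twoPaths-even : ∀ a b → a ≢ b → Deg0or2 (TwoPaths a b)
  twoPaths-even a b a≢b hubA =
    inj₂ ((a , zero) , (b , zero) , (λ e → a≢b (cong proj₁ e)) , inj₁ refl , inj₂ refl ,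
          first-incident-hubA a , first-incident-hubA b , only)
    where
    only : ∀ e → TwoPaths a b e → Inc e hubA → e ≡ (a , zero) ⊎ e ≡ (b , zero)
    only (i , k) (inj₁ refl) inc = inj₁ (cong (i ,_) (incident-hubA⇒first i k inc))
    only (i , k) (inj₂ refl) inc = inj₂ (cong (i ,_) (incident-hubA⇒first i k inc))
  twoPaths-even a b a≢b hubB =
    inj₂ ((a , fromℕ (ℓ a)) , (b , fromℕ (ℓ b)) , (λ e → a≢b (cong proj₁ e)) , inj₁ refl , inj₂ refl ,
          last-incident-hubB a , last-incident-hubB b , only)
    where
    only : ∀ e → TwoPaths a b e → Inc e hubB → e ≡ (a , fromℕ (ℓ a)) ⊎ e ≡ (b , fromℕ (ℓ b))
    only (i , k) (inj₁ refl) inc = inj₁ (cong (i ,_) (incident-hubB⇒last i k inc))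
    only (i , k) (inj₂ refl) inc = inj₂ (cong (i ,_) (incident-hubB⇒last i k inc))
  twoPaths-even a b a≢b (inner c x) with c ≟ a | c ≟ b
  ... | yes refl | _ = inj₂ ((c , inject₁ x) , (c , suc x) , before≢after c x , inj₁ refl , inj₁ refl ,
          before-incident-inner c x , after-incident-inner c x , (λ e _ inc → incident-inner⇒ e c x inc))
  ... | no _ | yes refl = inj₂ ((c , inject₁ x) , (c , suc x) , before≢after c x , inj₂ refl , inj₂ refl ,
          before-incident-inner c x , after-incident-inner c x , (λ e _ inc → incident-inner⇒ e c x inc))
  ... | no c≢a | no c≢b = inj₁ λ e e∈ab inc →
    [ c≢a , c≢b ]′ (subst (OneOf a b) ([ cong proj₁ , cong proj₁ ]′ (incident-inner⇒ e c x inc)) e∈ab)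

  twoPaths-minimal : ∀ a b (D : EdgeSet) → (∀ e → D e → TwoPaths a b e) → Deg0or2 D → NonEmpty D →
                     ∀ e → TwoPaths a b e → D e
  twoPaths-minimal a b D D⊆ deg ((c , k) , dck) (i , m) i∈ab
    with even-second-path deg c (even-whole-path deg c k zero dck)
  ... | c′ , c′≢c , dc′ with i ≟ c
  ... | yes refl = even-whole-path deg i k m dck
  ... | no i≢c with pair-other (D⊆ _ dck) (D⊆ _ dc′) i∈ab c′≢c i≢c
  ... | refl = even-whole-path deg i zero m dc′

  isCycle-resp : ∀ {C C′ : EdgeSet} → (∀ e → C e ⇔ C′ e) → IsCycle C → IsCycle C′
  isCycle-resp {C} {C′} C⇔C′ (deg , (e₀ , ce₀) , minimal) = deg′ , (e₀ , to (C⇔C′ e₀) ce₀) , minimal′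
    where
    deg′ : Deg0or2 C′
    deg′ w with deg w
    ... | inj₁ none = inj₁ (λ e c′ → none e (from (C⇔C′ e) c′))
    ... | inj₂ (e₁ , e₂ , e₁≢e₂ , c₁ , c₂ , inc₁ , inc₂ , only) =
      inj₂ (e₁ , e₂ , e₁≢e₂ , to (C⇔C′ e₁) c₁ , to (C⇔C′ e₂) c₂ , inc₁ , inc₂ , (λ e c′ → only e (from (C⇔C′ e) c′)))
    minimal′ : ∀ (D : EdgeSet) → (∀ e → D e → C′ e) → Deg0or2 D → NonEmpty D → ∀ e → C′ e → D e
    minimal′ D D⊆ degD neD e c′ = minimal D (λ e d → from (C⇔C′ e) (D⊆ e d)) degD neD e (from (C⇔C′ e) c′)

  twoPaths-isCycle : ∀ a b → a ≢ b → IsCycle (TwoPaths a b)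
  twoPaths-isCycle a b a≢b = twoPaths-even a b a≢b , ((a , zero) , inj₁ refl) , twoPaths-minimal a b

  isCycle⇔twoPathUnion : ∀ C → IsCycle C ⇔ IsTwoBlockUnion proj₁ C
  isCycle⇔twoPathUnion C = mk⇔ cycle⇒union union⇒cycle
    where
    cycle⇒union : IsCycle C → IsTwoBlockUnion proj₁ C
    cycle⇒union (deg , ((a , k) , cak) , minimal)
      with even-second-path deg a (even-whole-path deg a k zero cak)
    ... | b , b≢a , cb = a , b , a≢b , λ e → mk⇔ (minimal (TwoPaths a b) ⊆C (twoPaths-even a b a≢b)
                                                     ((a , zero) , inj₁ refl) e) (⊆C e)
      where
      a≢b : a ≢ b
      a≢b a≡b = b≢a (sym a≡b)
      ⊆C : ∀ e → TwoPaths a b e → C e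
      ⊆C (i , m) (inj₁ refl) = even-whole-path deg i k m cak
      ⊆C (i , m) (inj₂ refl) = even-whole-path deg i zero m cb
    union⇒cycle : IsTwoBlockUnion proj₁ C → IsCycle C
    union⇒cycle (a , b , a≢b , C⇔) = isCycle-resp (λ e → ⇔-sym (C⇔ e)) (twoPaths-isCycle a b a≢b)

-- The blocks of a surjection Fin n → Fin t as the paths of a subdivision

Fibre : ∀ {n t} → (Fin n → Fin t) → Fin t → Set
Fibre {n} β b = Σ (Fin n) λ j → β j ≡ b

sucIf : ∀ {A : Set} → Dec A → ℕ → ℕ
sucIf (yes _) m = suc m
sucIf (no _)  m = m

fibreSize : ∀ {n t} → (Fin n → Fin t) → Fin t → ℕ
fibreSize {zero}  β b = 0
fibreSize {suc n} β b = sucIf (β zero ≟ b) (fibreSize (λ j → β (suc j)) b)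

fibre→Fin : ∀ {n t} (β : Fin n → Fin t) b → Fibre β b → Fin (fibreSize β b)
fibre→Fin-step : ∀ {n t} (β : Fin (suc n) → Fin t) b (d : Dec (β zero ≡ b)) → Fibre β b →
                 Fin (sucIf d (fibreSize (λ j → β (suc j)) b))
fibre→Fin {suc n} β b = fibre→Fin-step β b (β zero ≟ b)
fibre→Fin-step β b (yes _)    (zero  , _)  = zero
fibre→Fin-step β b (no β₀≢b)  (zero  , β₀≡b) = ⊥-elim (β₀≢b β₀≡b)
fibre→Fin-step β b (yes _)    (suc j , βj≡b) = suc (fibre→Fin (λ j → β (suc j)) b (j , βj≡b))
fibre→Fin-step β b (no _)     (suc j , βj≡b) = fibre→Fin (λ j → β (suc j)) b (j , βj≡b)

Fin→fibre : ∀ {n t} (β : Fin n → Fin t) b → Fin (fibreSize β b) → Fibre β b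
Fin→fibre-step : ∀ {n t} (β : Fin (suc n) → Fin t) b (d : Dec (β zero ≡ b)) →
                 Fin (sucIf d (fibreSize (λ j → β (suc j)) b)) → Fibre β b
Fin→fibre {suc n} β b = Fin→fibre-step β b (β zero ≟ b)
Fin→fibre-step β b (yes β₀≡b) zero    = zero , β₀≡b
Fin→fibre-step β b (yes _)    (suc k) = let j , βj≡b = Fin→fibre (λ j → β (suc j)) b k in suc j , βj≡b
Fin→fibre-step β b (no _)     k       = let j , βj≡b = Fin→fibre (λ j → β (suc j)) b k in suc j , βj≡b

fibre→Fin∘Fin→fibre : ∀ {n t} (β : Fin n → Fin t) b k → fibre→Fin β b (Fin→fibre β b k) ≡ k
fibre→Fin∘Fin→fibre-step : ∀ {n t} (β : Fin (suc n) → Fin t) b d k →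
                           fibre→Fin-step β b d (Fin→fibre-step β b d k) ≡ k
fibre→Fin∘Fin→fibre {suc n} β b = fibre→Fin∘Fin→fibre-step β b (β zero ≟ b)
fibre→Fin∘Fin→fibre-step β b (yes _) zero    = refl
fibre→Fin∘Fin→fibre-step β b (yes _) (suc k) = cong suc (fibre→Fin∘Fin→fibre (λ j → β (suc j)) b k)
fibre→Fin∘Fin→fibre-step β b (no _)  k       = fibre→Fin∘Fin→fibre (λ j → β (suc j)) b k

Fin→fibre∘fibre→Fin : ∀ {n t} (β : Fin n → Fin t) b s → Fin→fibre β b (fibre→Fin β b s) ≡ s
Fin→fibre∘fibre→Fin-step : ∀ {n t} (β : Fin (suc n) → Fin t) b d s →
                           Fin→fibre-step β b d (fibre→Fin-step β b d s) ≡ s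
Fin→fibre∘fibre→Fin {suc n} β b = Fin→fibre∘fibre→Fin-step β b (β zero ≟ b)
Fin→fibre∘fibre→Fin-step β b (yes p) (zero , q) = cong (zero ,_) (Decidable⇒UIP.≡-irrelevant _≟_ p q)
Fin→fibre∘fibre→Fin-step β b (no p)  (zero , q) = ⊥-elim (p q)
Fin→fibre∘fibre→Fin-step β b (yes _) (suc j , q) =
  cong (λ s → suc (proj₁ s) , proj₂ s) (Fin→fibre∘fibre→Fin (λ j → β (suc j)) b (j , q))
Fin→fibre∘fibre→Fin-step β b (no _)  (suc j , q) =
  cong (λ s → suc (proj₁ s) , proj₂ s) (Fin→fibre∘fibre→Fin (λ j → β (suc j)) b (j , q))

nonempty⇒suc-pred : ∀ {m} → Fin m → m ≡ suc (pred m)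
nonempty⇒suc-pred {suc m} _ = refl

module PathsOfBlocks {n t} (β : Fin n → Fin t) (surj : ∀ b → Fibre β b) where
  ℓ : Fin t → ℕ
  ℓ b = pred (fibreSize β b)

  size≡ : ∀ b → fibreSize β b ≡ suc (ℓ b)
  size≡ b = nonempty⇒suc-pred (fibre→Fin β b (surj b))

  toEdge : Fin n → SubAE t ℓ
  toEdge j = β j , cast (size≡ (β j)) (fibre→Fin β (β j) (j , refl))

  fromEdge : SubAE t ℓ → Fin n
  fromEdge (b , k) = proj₁ (Fin→fibre β b (cast (sym (size≡ b)) k))

  β∘fromEdge : ∀ e → β (fromEdge e) ≡ proj₁ e
  β∘fromEdge (b , k) = proj₂ (Fin→fibre β b (cast (sym (size≡ b)) k))

  fromEdge∘toEdge : ∀ j → fromEdge (toEdge j) ≡ j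
  fromEdge∘toEdge j = cong proj₁ (begin
    Fin→fibre β (β j) (cast (sym (size≡ (β j))) (cast (size≡ (β j)) k))
      ≡⟨ cong (Fin→fibre β (β j)) (cast-involutive (sym (size≡ (β j))) (size≡ (β j)) k) ⟩
    Fin→fibre β (β j) k
      ≡⟨ Fin→fibre∘fibre→Fin β (β j) (j , refl) ⟩
    (j , refl) ∎)
    where
    open ≡-Reasoning
    k = fibre→Fin β (β j) (j , refl)

  toEdge-fibre : ∀ b (s : Fibre β b) → toEdge (proj₁ s) ≡ (b , cast (size≡ b) (fibre→Fin β b s))
  toEdge-fibre _ (j , refl) = refl

  toEdge∘fromEdge : ∀ e → toEdge (fromEdge e) ≡ e
  toEdge∘fromEdge (b , k) = trans (toEdge-fibre b (Fin→fibre β b k′))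
    (cong (b ,_) (trans (cong (cast (size≡ b)) (fibre→Fin∘Fin→fibre β b k′)) (cast-involutive (size≡ b) (sym (size≡ b)) k)))
    where
    k′ = cast (sym (size≡ b)) k

  blocks↔edges : Fin n ↔ SubAE t ℓ
  blocks↔edges = mk↔ₛ′ toEdge fromEdge toEdge∘fromEdge fromEdge∘toEdge

module FieldFacts (F : Field) where
  open Field F hiding (zero) renaming (refl to ≈-refl; sym to ≈-sym; trans to ≈-trans)
  open LinAlg F hiding (_∈T)
  open import Algebra.Properties.Ring ring using (-1*x≈-x; -‿+-comm; -0#≈0#)
  open import Algebra.Properties.CommutativeSemigroup +-commutativeSemigroup using (interchange)
  open import Relation.Binary.Reasoning.Setoid setoid

  x*y≈0⇒x≈0 : ∀ {x y} → x * y ≈ 0# → ¬ y ≈ 0# → x ≈ 0#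
  x*y≈0⇒x≈0 {x} {y} xy≈0 y≉0 = begin
    x             ≈⟨ *-identityʳ x ⟨
    x * 1#        ≈⟨ *-congˡ yy⁻¹≈1 ⟨
    x * (y * y⁻¹) ≈⟨ *-assoc x y y⁻¹ ⟨
    x * y * y⁻¹   ≈⟨ *-congʳ xy≈0 ⟩
    0# * y⁻¹      ≈⟨ zeroˡ y⁻¹ ⟩
    0#            ∎
    where
    y⁻¹ = proj₁ (inverse y y≉0)
    yy⁻¹≈1 = proj₂ (inverse y y≉0)

  x*y≈0⇔x≈0 : ∀ {x y} → ¬ y ≈ 0# → x * y ≈ 0# ⇔ x ≈ 0#
  x*y≈0⇔x≈0 {x} {y} y≉0 = mk⇔ (λ xy≈0 → x*y≈0⇒x≈0 xy≈0 y≉0) (λ x≈0 → ≈-trans (*-congʳ x≈0) (zeroˡ y))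

  *-nonzero : ∀ {x y} → ¬ x ≈ 0# → ¬ y ≈ 0# → ¬ x * y ≈ 0#
  *-nonzero x≉0 y≉0 xy≈0 = x≉0 (x*y≈0⇒x≈0 xy≈0 y≉0)

  ≈0-cong : ∀ {x y} → x ≈ y → x ≈ 0# ⇔ y ≈ 0#
  ≈0-cong x≈y = mk⇔ (≈-trans (≈-sym x≈y)) (≈-trans x≈y)

  divide : ∀ a {b} → ¬ b ≈ 0# → ∃ λ c → c * b ≈ a
  divide a {b} b≉0 = a * b⁻¹ , (begin
    a * b⁻¹ * b   ≈⟨ *-assoc a b⁻¹ b ⟩
    a * (b⁻¹ * b) ≈⟨ *-congˡ (≈-trans (*-comm b⁻¹ b) bb⁻¹≈1) ⟩
    a * 1#        ≈⟨ *-identityʳ a ⟩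
    a             ∎)
    where
    b⁻¹ = proj₁ (inverse b b≉0)
    bb⁻¹≈1 = proj₂ (inverse b b≉0)

  x-0≈x : ∀ x → x - 0# ≈ x
  x-0≈x x = ≈-trans (+-congˡ -0#≈0#) (+-identityʳ x)

  ∑-cong : ∀ {r} {f g : Fin r → Carrier} → (∀ i → f i ≈ g i) → ∑ f ≈ ∑ g
  ∑-cong {zero}  f≈g = ≈-refl
  ∑-cong {suc r} f≈g = +-cong (f≈g zero) (∑-cong (λ i → f≈g (suc i)))

  ∑-zero : ∀ {r} {f : Fin r → Carrier} → (∀ i → f i ≈ 0#) → ∑ f ≈ 0#
  ∑-zero {zero}  f≈0 = ≈-refl
  ∑-zero {suc r} f≈0 = ≈-trans (+-cong (f≈0 zero) (∑-zero (λ i → f≈0 (suc i)))) (+-identityˡ 0#)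

  ∑-*ʳ : ∀ {r} (f : Fin r → Carrier) x → ∑ (λ i → f i * x) ≈ ∑ f * x
  ∑-*ʳ {zero}  f x = ≈-sym (zeroˡ x)
  ∑-*ʳ {suc r} f x = ≈-trans (+-congˡ (∑-*ʳ (λ i → f (suc i)) x)) (≈-sym (distribʳ x (f zero) _))

  ∑-single : ∀ {r} (f : Fin r → Carrier) k → (∀ i → i ≢ k → f i ≈ 0#) → ∑ f ≈ f k
  ∑-single {suc r} f zero    f≈0 =
    ≈-trans (+-congˡ (∑-zero (λ i → f≈0 (suc i) λ ()))) (+-identityʳ (f zero))
  ∑-single {suc r} f (suc k) f≈0 =
    ≈-trans (+-congʳ (f≈0 zero λ ()))
      (≈-trans (+-identityˡ _) (∑-single (λ i → f (suc i)) k (λ i i≢k → f≈0 (suc i) (λ e → i≢k (suc-injective e)))))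

  ∑-sub : ∀ {r} (f g : Fin r → Carrier) → ∑ (λ i → f i - g i) ≈ ∑ f - ∑ g
  ∑-sub {zero}  f g = ≈-sym (-‿inverseʳ 0#)
  ∑-sub {suc r} f g = begin
    (f zero - g zero) + ∑ (λ i → f (suc i) - g (suc i)) ≈⟨ +-congˡ (∑-sub (λ i → f (suc i)) (λ i → g (suc i))) ⟩
    (f zero - g zero) + (∑f′ - ∑g′)                    ≈⟨ interchange (f zero) (- g zero) ∑f′ (- ∑g′) ⟩
    (f zero + ∑f′) + (- g zero + - ∑g′)                ≈⟨ +-congˡ (-‿+-comm (g zero) ∑g′) ⟩
    (f zero + ∑f′) - (g zero + ∑g′)                    ∎
    where
    ∑f′ = ∑ (λ i → f (suc i))
    ∑g′ = ∑ (λ i → g (suc i))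

  _⊖_ : ∀ {n} → Vect n → Vect n → Vect n
  (x ⊖ y) j = x j - y j

  _⊙_ : ∀ {n} → Carrier → Vect n → Vect n
  (a ⊙ x) j = a * x j

  module _ {n} (T : Subspace n) where
    open Subspace T using (_∈T)

    ⊖-closed : ∀ {x y} → x ∈T → y ∈T → (x ⊖ y) ∈T
    ⊖-closed {x} {y} x∈T y∈T =
      resp T (λ j → +-congˡ (-1*x≈-x (y j))) (+-closed T x∈T (*-closed T (- 1#) y∈T))

    lincomb-closed : ∀ {r} (c : Fin r → Carrier) (v : Fin r → Vect n) → (∀ i → v i ∈T) → lincomb c v ∈T
    lincomb-closed {zero}  c v v∈T = zero∈ T
    lincomb-closed {suc r} c v v∈T =
      +-closed T (*-closed T (c zero) (v∈T zero)) (lincomb-closed (λ i → c (suc i)) (λ i → v (suc i)) (λ i → v∈T (suc i)))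

-- Circuits of Matroid(T)

module Weights (F : Field) (_≈?_ : Decidable (Field._≈_ F)) {r : ℕ} where
  open Field F hiding (zero) renaming (refl to ≈-refl; sym to ≈-sym; trans to ≈-trans)
  open LinAlg F using (∑)
  open FieldFacts F

  weight : (Fin r → Carrier) → Fin (suc r) → Carrier
  weight c zero    = ∑ c
  weight c (suc k) = c k

  weight-no-singleton : ∀ c a → ¬ weight c a ≈ 0# → ∃ λ b → b ≢ a × ¬ weight c b ≈ 0#
  weight-no-singleton c zero ∑c≉0 =
    let k , ck≉0 = ¬∀⟶∃¬ r (λ k → c k ≈ 0#) (λ k → c k ≈? 0#) (λ c≈0 → ∑c≉0 (∑-zero c≈0))
    in suc k , (λ ()) , ck≉0
  weight-no-singleton c (suc k) ck≉0 with ∑ c ≈? 0#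
  ... | no ∑c≉0 = zero , (λ ()) , ∑c≉0
  ... | yes ∑c≈0 =
    let m , ¬[m≢k→cm≈0] = ¬∀⟶∃¬ r (λ m → m ≢ k → c m ≈ 0#) (λ m → ¬? (m ≟ k) →-dec c m ≈? 0#)
                            (λ others≈0 → ck≉0 (≈-trans (≈-sym (∑-single c k others≈0)) ∑c≈0))
    in suc m , (λ m≡k → ¬[m≢k→cm≈0] (λ m≢k → ⊥-elim (m≢k (suc-injective m≡k))))
             , (λ cm≈0 → ¬[m≢k→cm≈0] (λ _ → cm≈0))

  module _ {a b : Fin (suc r)} (a≢b : a ≢ b) {c : Fin r → Carrier}
           (vanishes : ∀ p → p ≢ a → p ≢ b → weight c p ≈ 0#) where

    nonzero⇒oneOf : ∀ {p} → ¬ weight c p ≈ 0# → OneOf a b p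
    nonzero⇒oneOf {p} w≉0 with p ≟ a | p ≟ b
    ... | yes p≡a | _       = inj₁ p≡a
    ... | no _    | yes p≡b = inj₂ p≡b
    ... | no p≢a  | no p≢b  = ⊥-elim (w≉0 (vanishes p p≢a p≢b))

    oneOf⇒nonzero : ∀ {p} → ¬ weight c p ≈ 0# → ∀ q → OneOf a b q → ¬ weight c q ≈ 0#
    oneOf⇒nonzero {p} wp≉0 q q∈ab with q ≟ p
    ... | yes refl = wp≉0
    ... | no q≢p =
      let p′ , p′≢p , wp′≉0 = weight-no-singleton c p wp≉0
      in subst (λ s → ¬ weight c s ≈ 0#)
           (sym (pair-other (nonzero⇒oneOf wp≉0) (nonzero⇒oneOf wp′≉0) q∈ab p′≢p q≢p)) wp′≉0

  unit : Fin r → Fin r → Carrier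
  unit k i with i ≟ k
  ... | yes _ = 1#
  ... | no  _ = 0#

  unit-diag : ∀ k → unit k k ≈ 1#
  unit-diag k with k ≟ k
  ... | yes _   = ≈-refl
  ... | no  k≢k = ⊥-elim (k≢k refl)

  unit-off : ∀ {k i} → i ≢ k → unit k i ≈ 0#
  unit-off {k} {i} i≢k with i ≟ k
  ... | yes i≡k = ⊥-elim (i≢k i≡k)
  ... | no  _   = ≈-refl

  ∑-unit : ∀ k → ∑ (unit k) ≈ 1#
  ∑-unit k = ≈-trans (∑-single (unit k) k (λ i → unit-off)) (unit-diag k)

  pair-weight : ∀ {a b} → a ≢ b →
                ∃ λ c → ¬ weight c a ≈ 0# × (∀ p → p ≢ a → p ≢ b → weight c p ≈ 0#)
  pair-weight {zero}  {zero}  0≢0 = ⊥-elim (0≢0 refl)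
  pair-weight {zero}  {suc k} _   = unit k , (λ ∑≈0 → 1≉0 (≈-trans (≈-sym (∑-unit k)) ∑≈0)) , vanishes
    where
    vanishes : ∀ p → p ≢ zero → p ≢ suc k → weight (unit k) p ≈ 0#
    vanishes zero    p≢0 _    = ⊥-elim (p≢0 refl)
    vanishes (suc m) _   m≢k = unit-off (λ m≡k → m≢k (cong suc m≡k))
  pair-weight {suc k} {zero}  _   = unit k , (λ ukk≈0 → 1≉0 (≈-trans (≈-sym (unit-diag k)) ukk≈0)) , vanishes
    where
    vanishes : ∀ p → p ≢ suc k → p ≢ zero → weight (unit k) p ≈ 0#
    vanishes zero    _   p≢0 = ⊥-elim (p≢0 refl)
    vanishes (suc m) m≢k _   = unit-off (λ m≡k → m≢k (cong suc m≡k))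
  pair-weight {suc k} {suc m} k≢m = c , (λ ck≈0 → 1≉0 (≈-trans (≈-sym ck≈1) ck≈0)) , vanishes
    where
    c : Fin r → Carrier
    c i = unit k i - unit m i
    ck≈1 : c k ≈ 1#
    ck≈1 = ≈-trans (+-cong (unit-diag k) (-‿cong (unit-off (λ k≡m → k≢m (cong suc k≡m))))) (x-0≈x 1#)
    vanishes : ∀ p → p ≢ suc k → p ≢ suc m → weight c p ≈ 0#
    vanishes zero    _   _   =
      ≈-trans (∑-sub (unit k) (unit m)) (≈-trans (+-cong (∑-unit k) (-‿cong (∑-unit m))) (-‿inverseʳ 1#))
    vanishes (suc p) p≢k p≢m =
      ≈-trans (+-cong (unit-off (λ p≡k → p≢k (cong suc p≡k))) (-‿cong (unit-off (λ p≡m → p≢m (cong suc p≡m)))))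
              (x-0≈x 0#)

module Circuits (F : Field) (_≈?_ : Decidable (Field._≈_ F)) {n : ℕ} (T : LinAlg.Subspace F n) where
  open Field F hiding (zero) renaming (refl to ≈-refl; sym to ≈-sym; trans to ≈-trans)
  open LinAlg F hiding (_∈T)
  open Subspace T using (_∈T)
  open FieldFacts F
  open import Algebra.Properties.Ring ring using (x∙y⁻¹≈ε⇒x≈y; x≈y⇒x∙y⁻¹≈ε)

  ≈-stable : ∀ {x y} → ¬ ¬ x ≈ y → x ≈ y
  ≈-stable {x} {y} = decidable-stable (x ≈? y)

  nonzero-somewhere : ∀ {x : Vect n} → ¬ IsZero x → ∃ λ j → support x j
  nonzero-somewhere {x} x≢0 = ¬∀⟶∃¬ n (λ j → x j ≈ 0#) (λ j → x j ≈? 0#) x≢0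

  outside-support : ∀ {S : SubsetN n} {x : Vect n} {j} → IsSupportOf S x → ¬ S j → x j ≈ 0#
  outside-support {j = j} S-supp ¬Sj = ≈-stable (λ xj≉0 → ¬Sj (proj₂ (S-supp j) xj≉0))

  isNonzero : Carrier → Bool
  isNonzero a = does (¬? (a ≈? 0#))

  isNonzero⇔ : ∀ a → isNonzero a ≡ true ⇔ (¬ a ≈ 0#)
  isNonzero⇔ a with a ≈? 0#
  ... | yes a≈0 = mk⇔ (λ ()) (λ a≉0 → ⊥-elim (a≉0 a≈0))
  ... | no  a≉0 = mk⇔ (λ _ → a≉0) (λ _ → refl)

  supportSet : Vect n → Subset.Subset n
  supportSet x = tabulate (λ j → isNonzero (x j))

  ∈-supportSet : ∀ x j → j Subset.∈ supportSet x ⇔ support x j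
  ∈-supportSet x j = ⇔-trans
    (mk⇔ (λ j∈ → trans (sym (lookup∘tabulate _ j)) ([]=⇒lookup j∈))
         (λ xj≢0 → lookup⇒[]= j _ (trans (lookup∘tabulate _ j) xj≢0)))
    (isNonzero⇔ (x j))

  CircuitWithin : Vect n → Set₁
  CircuitWithin y = Σ (SubsetN n) λ S → IsCircuit T S × S ⊆ support y

  -- Minimality of a support is undecidable, hence the double negation; every use of it
  -- concludes a stable statement.
  ¬¬circuitWithin : ∀ y → y ∈T → ¬ IsZero y → ¬ ¬ CircuitWithin y
  ¬¬circuitWithin y = go y (⊂-wellFounded (supportSet y))
    where
    go : ∀ y → Acc Subset._⊂_ (supportSet y) → y ∈T → ¬ IsZero y → ¬ ¬ CircuitWithin y
    go y (acc smaller) y∈T y≢0 noCircuit =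
      noCircuit (support y , ((y , y∈T , y≢0 , λ _ → (λ s → s) , (λ s → s)) , minimal) , λ _ s → s)
      where
      minimal : ∀ z → z ∈T → ¬ IsZero z → support z ⊆ support y → support y ⊆ support z
      minimal z z∈T z≢0 z⊆y i yi≉0 zi≈0 =
        go z (smaller (shrinks , i , from (∈-supportSet y i) yi≉0 , λ i∈z → to (∈-supportSet z i) i∈z zi≈0))
           z∈T z≢0 (λ (S , S-circuit , S⊆z) → noCircuit (S , S-circuit , λ j s → z⊆y j (S⊆z j s)))
        where
        shrinks : supportSet z Subset.⊆ supportSet y
        shrinks {j} j∈z = from (∈-supportSet y j) (z⊆y j (to (∈-supportSet z j) j∈z))

  circuit⇔support : ∀ {S y} → IsCircuit T S → y ∈T → ¬ IsZero y → support y ⊆ S → ∀ j → S j ⇔ support y j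
  circuit⇔support (_ , minimal) y∈T y≢0 y⊆S j = mk⇔ (minimal _ y∈T y≢0 y⊆S j) (y⊆S j)

  rescale : ∀ {S : SubsetN n} {x} → x ∈T → IsSupportOf S x → ∀ {j} → S j →
            ∃ λ w → w ∈T × IsSupportOf S w × w j ≈ 1#
  rescale {S} {x} x∈T x-supp {j} Sj with divide 1# (proj₁ (x-supp j) Sj)
  ... | μ , μxj≈1 = μ ⊙ x , *-closed T μ x∈T , μx-supp , μxj≈1
    where
    μ≉0 : ¬ μ ≈ 0#
    μ≉0 μ≈0 = 1≉0 (≈-trans (≈-sym μxj≈1) (≈-trans (*-congʳ μ≈0) (zeroˡ (x j))))
    μx-supp : IsSupportOf S (μ ⊙ x)
    μx-supp i = (λ Si → *-nonzero μ≉0 (proj₁ (x-supp i) Si))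
              , (λ μxi≉0 → proj₂ (x-supp i) (λ xi≈0 → μxi≉0 (≈-trans (*-congˡ xi≈0) (zeroʳ μ))))

  TwoBlockCircuits : ∀ {t} → (Fin n → Fin t) → Set₁
  TwoBlockCircuits β = ∀ S → IsCircuit T S ⇔ IsTwoBlockUnion β S

  module _ {t} {β : Fin n → Fin t} (circuits : TwoBlockCircuits β) where

    zero-off-one-block : ∀ {y} → y ∈T → (c : Fin t) →
                         (∀ a → a ≢ c → ∃ λ j → β j ≡ a × y j ≈ 0#) → IsZero y
    zero-off-one-block {y} y∈T c vanishes j =
      ≈-stable λ yj≉0 → ¬¬circuitWithin y y∈T (λ y≈0 → yj≉0 (y≈0 j)) noCircuit
      where
      noCircuit : ¬ CircuitWithin y
      noCircuit (S , S-circuit , S⊆y) = avoid (to (circuits S) S-circuit)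
        where
        blocked : ∀ {a b} → (∀ j → S j ⇔ OneOf a b (β j)) → ∀ d → d ≢ c → OneOf a b d → ⊥
        blocked S⇔ d d≢c d∈ab with vanishes d d≢c
        ... | j′ , refl , yj′≈0 = S⊆y j′ (from (S⇔ j′) d∈ab) yj′≈0
        avoid : ¬ IsTwoBlockUnion β S
        avoid (a , b , a≢b , S⇔) with a ≟ c
        ... | yes refl = blocked S⇔ b (λ b≡a → a≢b (sym b≡a)) (inj₂ refl)
        ... | no a≢c   = blocked S⇔ a a≢c (inj₁ refl)

    agree-off-one-block : ∀ {y y′} → y ∈T → y′ ∈T → (c : Fin t) →
                          (∀ a → a ≢ c → ∃ λ j → β j ≡ a × y j ≈ y′ j) → ∀ j → y j ≈ y′ j
    agree-off-one-block {y} {y′} y∈T y′∈T c agrees j =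
      x∙y⁻¹≈ε⇒x≈y (y j) (y′ j) (zero-off-one-block (⊖-closed T y∈T y′∈T) c vanishes j)
      where
      vanishes : ∀ a → a ≢ c → ∃ λ j → β j ≡ a × (y ⊖ y′) j ≈ 0#
      vanishes a a≢c = let j , βj≡a , yj≈y′j = agrees a a≢c in j , βj≡a , x≈y⇒x∙y⁻¹≈ε yj≈y′j

  module SunflowerBlocks {r} (β : Fin n → Fin (suc r)) (v : Fin r → Vect n) (u⁰ : Vect n)
    (core  : ∀ i j → β j ≡ zero → v i j ≈ u⁰ j)
    (core≉0 : ∀ j → β j ≡ zero → ¬ u⁰ j ≈ 0#)
    (petal : ∀ i j → β j ≡ suc i → ¬ (v i j ≈ 0#))
    (off   : ∀ i k j → β j ≡ suc k → k ≢ i → v i j ≈ 0#) where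
    open Weights F _≈?_ {r}

    lincomb-on-core : ∀ c j → β j ≡ zero → lincomb c v j ≈ ∑ c * u⁰ j
    lincomb-on-core c j βj≡0 = ≈-trans (∑-cong (λ i → *-congˡ (core i j βj≡0))) (∑-*ʳ c (u⁰ j))

    lincomb-on-petal : ∀ c j k → β j ≡ suc k → lincomb c v j ≈ c k * v k j
    lincomb-on-petal c j k βj≡k = ∑-single (λ i → c i * v i j) k
      (λ i i≢k → ≈-trans (*-congˡ (off i k j βj≡k (λ k≡i → i≢k (sym k≡i)))) (zeroʳ (c i)))

    lincomb≈0⇔weight≈0 : ∀ c j → lincomb c v j ≈ 0# ⇔ weight c (β j) ≈ 0#
    lincomb≈0⇔weight≈0 c j with β j in βj
    ... | zero  = ⇔-trans (≈0-cong (lincomb-on-core c j βj)) (x*y≈0⇔x≈0 (core≉0 j βj))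
    ... | suc k = ⇔-trans (≈0-cong (lincomb-on-petal c j k βj)) (x*y≈0⇔x≈0 (petal k j βj))

    linearIndependent : (∀ b → ∃ λ j → β j ≡ b) → ∀ c → IsZero (lincomb c v) → ∀ i → c i ≈ 0#
    linearIndependent surj c c·v≈0 i =
      let j , βj≡i = surj (suc i)
      in subst (λ b → weight c b ≈ 0#) βj≡i (to (lincomb≈0⇔weight≈0 c j) (c·v≈0 j))

  module FromSunflower {r} {v : Fin r → Vect n} (basis : IsBasis T v)
    (β : Fin n → Fin (suc r)) (u⁰ : Vect n) (surj : ∀ b → ∃ λ j → β j ≡ b)
    (core   : ∀ i j → β j ≡ zero → v i j ≈ u⁰ j)
    (core≉0 : ∀ j → β j ≡ zero → ¬ u⁰ j ≈ 0#)
    (petal  : ∀ i j → β j ≡ suc i → ¬ (v i j ≈ 0#))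
    (off    : ∀ i k j → β j ≡ suc k → k ≢ i → v i j ≈ 0#) where
    open SunflowerBlocks β v u⁰ core core≉0 petal off
    open Weights F _≈?_ {r}

    weightOf : ∀ {y} → y ∈T → ∃ λ c → ∀ j → y j ≈ 0# ⇔ weight c (β j) ≈ 0#
    weightOf y∈T with proj₂ (proj₂ basis) _ y∈T
    ... | c , y≋c·v = c , λ j → ⇔-trans (≈0-cong (y≋c·v j)) (lincomb≈0⇔weight≈0 c j)

    fills-pair : ∀ {a b y} → a ≢ b → y ∈T → ¬ IsZero y →
                 (∀ j → support y j → OneOf a b (β j)) → ∀ j → OneOf a b (β j) → support y j
    fills-pair {a} {b} {y} a≢b y∈T y≢0 y⊆ab with weightOf y∈T | nonzero-somewhere y≢0
    ... | c , zeros | j₀ , yj₀≉0 = λ j j∈ab yj≈0 →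
      oneOf⇒nonzero a≢b vanishes {β j₀} (yj₀≉0 ∘ from (zeros j₀)) (β j) j∈ab (to (zeros j) yj≈0)
      where
      vanishes : ∀ p → p ≢ a → p ≢ b → weight c p ≈ 0#
      vanishes p p≢a p≢b with surj p
      ... | j , refl = to (zeros j) (≈-stable λ yj≉0 → [ p≢a , p≢b ]′ (y⊆ab j yj≉0))

    pairVector : ∀ {a b} → a ≢ b → ∃ λ y → y ∈T × ¬ IsZero y × ∀ j → support y j ⇔ OneOf a b (β j)
    pairVector {a} {b} a≢b with pair-weight a≢b
    ... | c , ca≉0 , vanishes =
      lincomb c v , y∈T , y≢0 , λ j → mk⇔ (y⊆ab j) (fills-pair a≢b y∈T y≢0 y⊆ab j)
      where
      y∈T = lincomb-closed T c v (proj₁ basis)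
      y⊆ab : ∀ j → support (lincomb c v) j → OneOf a b (β j)
      y⊆ab j yj≉0 = nonzero⇒oneOf a≢b vanishes (yj≉0 ∘ from (lincomb≈0⇔weight≈0 c j))
      y≢0 : ¬ IsZero (lincomb c v)
      y≢0 y≈0 with surj a
      ... | j , refl = ca≉0 (to (lincomb≈0⇔weight≈0 c j) (y≈0 j))

    twoBlockCircuits : TwoBlockCircuits β
    twoBlockCircuits S = mk⇔ circuit⇒union union⇒circuit
      where
      union⇒circuit : IsTwoBlockUnion β S → IsCircuit T S
      union⇒circuit (a , b , a≢b , S⇔) with pairVector a≢b
      ... | y , y∈T , y≢0 , y⇔ = (y , y∈T , y≢0 , λ j → from (y⇔S j) , to (y⇔S j)) , minimal
        where
        y⇔S : ∀ j → support y j ⇔ S j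
        y⇔S j = ⇔-trans (y⇔ j) (⇔-sym (S⇔ j))
        minimal : ∀ z → z ∈T → ¬ IsZero z → support z ⊆ S → S ⊆ support z
        minimal z z∈T z≢0 z⊆S j Sj =
          fills-pair a≢b z∈T z≢0 (λ j zj≉0 → to (S⇔ j) (z⊆S j zj≉0)) j (to (S⇔ j) Sj)
      circuit⇒union : IsCircuit T S → IsTwoBlockUnion β S
      circuit⇒union S-circuit@((x , x∈T , x≢0 , x-supp) , _) with weightOf x∈T | nonzero-somewhere x≢0
      ... | c , zeros | j₀ , xj₀≉0 with weight-no-singleton c (β j₀) (xj₀≉0 ∘ from (zeros j₀))
      ... | b , b≢a , wb≉0 with pairVector (b≢a ∘ sym)
      ... | y , y∈T , y≢0 , y⇔ =
        β j₀ , b , b≢a ∘ sym , λ j → ⇔-trans (circuit⇔support S-circuit y∈T y≢0 y⊆S j) (y⇔ j)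
        where
        nonzero : ∀ {j d} → ¬ weight c d ≈ 0# → β j ≡ d → support x j
        nonzero {j} wd≉0 refl = wd≉0 ∘ to (zeros j)
        y⊆S : support y ⊆ S
        y⊆S j yj≉0 = proj₂ (x-supp j) ([ nonzero (xj₀≉0 ∘ from (zeros j₀)) , nonzero wb≉0 ]′ (to (y⇔ j) yj≉0))

  module FromTwoBlockCircuits {r} (β : Fin n → Fin (suc r)) (surj : ∀ b → ∃ λ j → β j ≡ b)
                              (circuits : TwoBlockCircuits β) (i₀ : Fin r) where

    rep : Fin (suc r) → Fin n
    rep b = proj₁ (surj b)

    rep-in : ∀ b → β (rep b) ≡ b
    rep-in b = proj₂ (surj b)

    j₀ : Fin n
    j₀ = rep zero

    circuitVector : ∀ {a b} → a ≢ b → ∃ λ x → x ∈T × IsSupportOf (λ j → OneOf a b (β j)) x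
    circuitVector a≢b with from (circuits _) (_ , _ , a≢b , λ _ → ⇔-refl)
    ... | (x , x∈T , _ , x-supp) , _ = x , x∈T , x-supp

    normalised : ∀ k → ∃ λ w → w ∈T × IsSupportOf (λ j → OneOf zero (suc k) (β j)) w × w j₀ ≈ 1#
    normalised k with circuitVector {zero} {suc k} 0≢1+n
    ... | x , x∈T , x-supp = rescale x∈T x-supp (inj₁ (rep-in zero))

    v : Fin r → Vect n
    v k = proj₁ (normalised k)

    v∈T : ∀ k → v k ∈T
    v∈T k = proj₁ (proj₂ (normalised k))

    v-support : ∀ k → IsSupportOf (λ j → OneOf zero (suc k) (β j)) (v k)
    v-support k = proj₁ (proj₂ (proj₂ (normalised k)))

    v-j₀ : ∀ k → v k j₀ ≈ 1#
    v-j₀ k = proj₂ (proj₂ (proj₂ (normalised k)))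

    petal : ∀ i j → β j ≡ suc i → ¬ v i j ≈ 0#
    petal i j βj≡i = proj₁ (v-support i j) (inj₂ βj≡i)

    off : ∀ i k j → β j ≡ suc k → k ≢ i → v i j ≈ 0#
    off i k j βj≡k k≢i = outside-support (v-support i) [ (λ βj≡0 → 0≢1+n (trans (sym βj≡0) βj≡k))
                                                       , (λ βj≡i → k≢i (suc-injective (trans (sym βj≡k) βj≡i))) ]′

    zero∉petals : ∀ {j a b} → β j ≡ zero → ¬ OneOf (suc a) (suc b) (β j)
    zero∉petals βj≡0 = [ (λ βj≡a → 0≢1+n (trans (sym βj≡0) βj≡a)) , (λ βj≡b → 0≢1+n (trans (sym βj≡0) βj≡b)) ]′

    -- Subtracting from vⁱ the multiple of a circuit vector on Bᵢ ∪ Bᵢ₀ that cancels vⁱ on Bᵢ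
    -- leaves a vector of T agreeing with vⁱ⁰ at a point of every block except Bᵢ₀.
    core-agree : ∀ i → i ≢ i₀ → ∀ j → β j ≡ zero → v i j ≈ v i₀ j
    core-agree i i≢i₀ with circuitVector {suc i} {suc i₀} (i≢i₀ ∘ suc-injective)
    ... | Z , Z∈T , Z-supp with divide (v i (rep (suc i))) (proj₁ (Z-supp (rep (suc i))) (inj₁ (rep-in (suc i))))
    ... | μ , μZk≈vik = λ j βj≡0 → ≈-trans (≈-sym (w≈vi j (Z-off (zero∉petals βj≡0)))) (w≈vi₀ j)
      where
      k = rep (suc i)
      w = v i ⊖ (μ ⊙ Z)
      Z-off : ∀ {j} → ¬ OneOf (suc i) (suc i₀) (β j) → Z j ≈ 0#
      Z-off = outside-support Z-supp
      w≈vi : ∀ j → Z j ≈ 0# → w j ≈ v i j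
      w≈vi j Zj≈0 = ≈-trans (+-congˡ (-‿cong (≈-trans (*-congˡ Zj≈0) (zeroʳ μ)))) (x-0≈x (v i j))
      agreement : ∀ a → a ≢ suc i₀ → ∃ λ j → β j ≡ a × w j ≈ v i₀ j
      agreement zero _ = j₀ , rep-in zero ,
        ≈-trans (w≈vi j₀ (Z-off (zero∉petals (rep-in zero)))) (≈-trans (v-j₀ i) (≈-sym (v-j₀ i₀)))
      agreement (suc p) p≢i₀ with p ≟ i
      ... | yes refl = k , rep-in (suc i) ,
        ≈-trans (≈-trans (+-congˡ (-‿cong μZk≈vik)) (-‿inverseʳ (v i k))) (≈-sym (off i₀ i k (rep-in (suc i)) i≢i₀))
      ... | no p≢i = rep (suc p) , rep-in (suc p) ,
        ≈-trans (w≈vi _ (Z-off [ (λ p≡i → p≢i (suc-injective (trans (sym (rep-in (suc p))) p≡i)))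
                               , (λ p≡i₀ → p≢i₀ (trans (sym (rep-in (suc p))) p≡i₀)) ]′))
          (≈-trans (off i p _ (rep-in (suc p)) p≢i) (≈-sym (off i₀ p _ (rep-in (suc p)) (p≢i₀ ∘ cong suc))))
      w≈vi₀ : ∀ j → w j ≈ v i₀ j
      w≈vi₀ = agree-off-one-block circuits (⊖-closed T (v∈T i) (*-closed T μ Z∈T)) (v∈T i₀) (suc i₀) agreement

    core : ∀ i j → β j ≡ zero → v i j ≈ v i₀ j
    core i j βj≡0 with i ≟ i₀
    ... | yes refl  = ≈-refl
    ... | no  i≢i₀ = core-agree i i≢i₀ j βj≡0

    core≉0 : ∀ j → β j ≡ zero → ¬ v i₀ j ≈ 0#
    core≉0 j βj≡0 = proj₁ (v-support i₀ j) (inj₁ βj≡0)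

    open SunflowerBlocks β v (v i₀) core core≉0 petal off

    spanning : ∀ y → y ∈T → ∃ λ c → y ≋ lincomb c v
    spanning y y∈T = c , agree-off-one-block circuits y∈T (lincomb-closed T c v v∈T) zero agreement
      where
      quotient : ∀ p → ∃ λ γ → γ * v p (rep (suc p)) ≈ y (rep (suc p))
      quotient p = divide (y (rep (suc p))) (petal p _ (rep-in (suc p)))
      c : Fin r → Carrier
      c p = proj₁ (quotient p)
      agreement : ∀ a → a ≢ zero → ∃ λ j → β j ≡ a × y j ≈ lincomb c v j
      agreement zero    0≢0 = ⊥-elim (0≢0 refl)
      agreement (suc p) _   = rep (suc p) , rep-in (suc p) ,
        ≈-sym (≈-trans (lincomb-on-petal c _ p (rep-in (suc p))) (proj₂ (quotient p)))

    hasSunflowerBasis : 2 ≤ r → HasSunflowerBasis T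
    hasSunflowerBasis 2≤r = r , v , (v∈T , linearIndependent surj , spanning) ,
      2≤r , β , v i₀ , surj , (λ i j βj≡0 → core i j βj≡0 , core≉0 j βj≡0) , petal , off

module _ (F : Field) (_≈?_ : Decidable (Field._≈_ F)) {n : ℕ} (T : LinAlg.Subspace F n) where
  open LinAlg F using (HasSunflowerBasis)
  open Circuits F _≈?_ T

  cycles⇔twoBlockUnions : ∀ {t ℓ} (φ : Fin n ↔ SubAE t ℓ) {β : Fin n → Fin t} →
                          (∀ e → β (Inverse.from φ e) ≡ proj₁ e) → ∀ S →
                          GraphNotions.IsCycle (SubA t ℓ) (λ e → S (Inverse.from φ e)) ⇔ IsTwoBlockUnion β S
  cycles⇔twoBlockUnions {t} {ℓ} φ β∘from S =
    ⇔-trans (SubdivisionCycles.isCycle⇔twoPathUnion t ℓ _) (twoBlockUnion-transport φ β∘from S)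

  subdivision⇒sunflowerBasis : IsCycleMatroidOfSubdivA F T → HasSunflowerBasis T
  subdivision⇒sunflowerBasis (suc (suc (suc r)) , ℓ , s≤s (s≤s (s≤s z≤n)) , φ , circuit⇔cycle) =
    FromTwoBlockCircuits.hasSunflowerBasis β surj circuits zero (s≤s (s≤s z≤n))
    where
    β : Fin n → Fin (suc (suc (suc r)))
    β j = proj₁ (Inverse.to φ j)
    β∘from : ∀ e → β (Inverse.from φ e) ≡ proj₁ e
    β∘from e = cong proj₁ (Inverse.strictlyInverseˡ φ e)
    surj : ∀ b → ∃ λ j → β j ≡ b
    surj b = Inverse.from φ (b , zero) , β∘from (b , zero)
    circuits : TwoBlockCircuits β
    circuits S = let cycle⇔ = cycles⇔twoBlockUnions φ β∘from S in
      mk⇔ (to cycle⇔ ∘ proj₁ (circuit⇔cycle S)) (proj₂ (circuit⇔cycle S) ∘ from cycle⇔)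

  sunflowerBasis⇒subdivision : HasSunflowerBasis T → IsCycleMatroidOfSubdivA F T
  sunflowerBasis⇒subdivision (suc (suc r) , v , basis , s≤s (s≤s z≤n) , β , u⁰ , surj , core , petal , off) =
    suc (suc (suc r)) , ℓ , s≤s (s≤s (s≤s z≤n)) , blocks↔edges , λ S →
      let cycle⇔ = cycles⇔twoBlockUnions blocks↔edges β∘fromEdge S in
      from cycle⇔ ∘ to (circuits S) , from (circuits S) ∘ to cycle⇔
    where
    open PathsOfBlocks β surj
    circuits : TwoBlockCircuits β
    circuits = FromSunflower.twoBlockCircuits basis β u⁰ surj
      (λ i j βj≡0 → proj₁ (core i j βj≡0)) (λ j βj≡0 → proj₂ (core zero j βj≡0)) petal off

≈-decidable : (F : Field) {q : ℕ} → HasOrder F q → Decidable (Field._≈_ F)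
≈-decidable F order = via-injection (Inverse⇒Injection order) _≟_

lemma3p5 : (F : Field) (q : ℕ) → IsPrimePower q → HasOrder F q →
           (n : ℕ) → 1 ≤ n → (T : LinAlg.Subspace F n) →
           (IsCycleMatroidOfSubdivA F T → LinAlg.HasSunflowerBasis F T)
           × (LinAlg.HasSunflowerBasis F T → IsCycleMatroidOfSubdivA F T)
lemma3p5 F q _ order n _ T =
  subdivision⇒sunflowerBasis F (≈-decidable F order) T , sunflowerBasis⇒subdivision F (≈-decidable F order) T
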